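{- Let $p$ be a prime, $q=p^s$ a power of $p$, and $a\in\mathbb{Z}_+$. Let $m$ be the smallest nonnegative integer with $a\le p^m$, put $r_a=(q-1)p^m$ and $j_{a,\max}=\lfloor (r_a-a)/(q-1)\rfloor$. For $j\in\{0,1,\dots,p^m-a\}$ let $i_j$ be the unique integer with $0\le i_j<q-1$ and $j+i_jp^m\equiv 0\pmod{q-1}$. Then the map $$\{0,1,\dots,p^m-a\}\to\{\,l(q-1)\mid 0\le l\le j_{a,\max}\,\},\qquad j\mapsto j+i_jp^m$$ is well defined and injective.
   Context: Since $\gcd(p^m,q-1)=1$, the integer $i_j$ exists and is unique. -}

module Defs where

open import Data.Nat using (ℕ; zero; suc; _∸_; _*_; _^_; _/_)

-- ⌊ n / d ⌋ ; the case d = 0 never arises in the statement (there d = q - 1 ≥ 1)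
floorDiv : ℕ → ℕ → ℕ
floorDiv n zero    = 0
floorDiv n (suc d) = n / suc d

rA : (q pm : ℕ) → ℕ
rA q pm = (q ∸ 1) * pm

jAmax : (q pm a : ℕ) → ℕ
jAmax q pm a = floorDiv (rA q pm ∸ a) (q ∸ 1)

module Submission where

-- Write Q = q - 1 and P = p^m.  The map  j ↦ j + i_j·P  reads the pair
-- (i_j, j) as the two "digits" of a number in mixed radix P, with the
-- high digit i_j < Q and the low digit j ≤ P - a < P.
--
--  * Well-definedness: j + i_j·P is a multiple l·Q by the defining
--    congruence of i_j, and it is at most (P - a) + (Q - 1)·P = Q·P - a = r_a - a,
--    so dividing by Q gives l ≤ ⌊(r_a - a)/Q⌋ = j_{a,max}.
--  * Injectivity: the low digit j is recovered as (j + i_j·P) mod P.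
--
-- The proposition then assembles them.

open import Defs
open import Data.Nat using (ℕ; suc; _+_; _*_; _∸_; _^_; _≤_; _<_; _/_; _%_)
open import Data.Nat.Divisibility using (_∣_; divides)
open import Data.Nat.Primality using (Prime)
open import Data.Nat.Properties
open import Data.Nat.DivMod using (m*n/n≡m; /-monoˡ-≤; m<n⇒m%n≡m; [m+kn]%n≡m%n)
open import Data.Product using (Σ; _×_; _,_)
open import Relation.Binary.PropositionalEquality using (_≡_; cong; subst; module ≡-Reasoning)

multiple≤⇒≤floorDiv : ∀ {Q} l y → 0 < Q → l * Q ≤ y → l ≤ floorDiv y Q
multiple≤⇒≤floorDiv {suc d} l y _ lQ≤y =
  subst (_≤ y / suc d) (m*n/n≡m l (suc d)) (/-monoˡ-≤ (suc d) lQ≤y)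

twoDigit-bound : ∀ {P a Q j i} → a ≤ P → j ≤ P ∸ a → i < Q → j + i * P ≤ Q * P ∸ a
twoDigit-bound {P} {a} {Q} {j} {i} a≤P j≤P∸a i<Q = m+n≤o⇒m≤o∸n (j + i * P) (begin
    j + i * P + a     ≡⟨ +-assoc j (i * P) a ⟩
    j + (i * P + a)   ≡⟨ cong (j +_) (+-comm (i * P) a) ⟩
    j + (a + i * P)   ≡⟨ +-assoc j a (i * P) ⟨
    j + a + i * P     ≤⟨ +-monoˡ-≤ (i * P) (+-monoˡ-≤ a j≤P∸a) ⟩
    P ∸ a + a + i * P ≡⟨ cong (_+ i * P) (m∸n+n≡m a≤P) ⟩
    suc i * P         ≤⟨ *-monoˡ-≤ P i<Q ⟩
    Q * P             ∎)
  where open ≤-Reasoning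

lowDigit-unique : ∀ {P j₁ j₂} i₁ i₂ → j₁ < P → j₂ < P →
                  j₁ + i₁ * P ≡ j₂ + i₂ * P → j₁ ≡ j₂
lowDigit-unique {suc d} {j₁} {j₂} i₁ i₂ j₁<P j₂<P same = begin
    j₁                        ≡⟨ m<n⇒m%n≡m j₁<P ⟨
    j₁ % suc d                ≡⟨ [m+kn]%n≡m%n j₁ i₁ (suc d) ⟨
    (j₁ + i₁ * suc d) % suc d ≡⟨ cong (_% suc d) same ⟩
    (j₂ + i₂ * suc d) % suc d ≡⟨ [m+kn]%n≡m%n j₂ i₂ (suc d) ⟩
    j₂ % suc d                ≡⟨ m<n⇒m%n≡m j₂<P ⟩
    j₂                        ∎
  where open ≡-Reasoning

≤∸⇒< : ∀ {P a j} → 1 ≤ a → a ≤ P → j ≤ P ∸ a → j < P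
≤∸⇒< 1≤a a≤P j≤P∸a = ≤-<-trans j≤P∸a (∸-monoʳ-< 1≤a a≤P)

proposition5p4 :
    (p s a m : ℕ) → Prime p → 1 ≤ s → 1 ≤ a →
    a ≤ p ^ m → (∀ k → k < m → p ^ k < a) →
    (i : ℕ → ℕ) →
    (∀ j → j ≤ p ^ m ∸ a → i j < p ^ s ∸ 1 × (p ^ s ∸ 1) ∣ j + i j * p ^ m) →
    (∀ j → j ≤ p ^ m ∸ a →
      Σ ℕ (λ l → l ≤ jAmax (p ^ s) (p ^ m) a × j + i j * p ^ m ≡ l * (p ^ s ∸ 1)))
    × (∀ j₁ j₂ → j₁ ≤ p ^ m ∸ a → j₂ ≤ p ^ m ∸ a →
      j₁ + i j₁ * p ^ m ≡ j₂ + i j₂ * p ^ m → j₁ ≡ j₂)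
proposition5p4 p s a m _ _ 1≤a a≤P _ i digit = wellDefined , injective
  where
  wellDefined : ∀ j → j ≤ p ^ m ∸ a →
    Σ ℕ (λ l → l ≤ jAmax (p ^ s) (p ^ m) a × j + i j * p ^ m ≡ l * (p ^ s ∸ 1))
  wellDefined j j≤P∸a with digit j j≤P∸a
  ... | i<Q , divides l image≡lQ =
    l , multiple≤⇒≤floorDiv l (rA (p ^ s) (p ^ m) ∸ a) (m<n⇒0<n i<Q)
          (subst (_≤ rA (p ^ s) (p ^ m) ∸ a) image≡lQ (twoDigit-bound a≤P j≤P∸a i<Q))
      , image≡lQ

  injective : ∀ j₁ j₂ → j₁ ≤ p ^ m ∸ a → j₂ ≤ p ^ m ∸ a →
    j₁ + i j₁ * p ^ m ≡ j₂ + i j₂ * p ^ m → j₁ ≡ j₂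
  injective j₁ j₂ j₁∈ j₂∈ =
    lowDigit-unique (i j₁) (i j₂) (≤∸⇒< 1≤a a≤P j₁∈) (≤∸⇒< 1≤a a≤P j₂∈)
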